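{- Let $D$ be a positive, odd, squarefree integer. For integers $u,v$ coprime with $D$ put \[ S_D(u,v)=\sum_{ab=D}\prod_{p\mid b}\left(1+\left(\frac{ua}{p}\right)\right)\prod_{p\mid a}\left(1+\left(\frac{vb}{p}\right)\right). \] Then $S_D(1,1)\neq 0$, and either $S_D(2,2)=0$ or $S_D(2,2)=S_D(1,1)$.
   Context: The sum is over ordered pairs $(a,b)$ of positive integers with $ab=D$, the products are over primes $p$, and $\left(\frac{\cdot}{p}\right)$ is the Legendre symbol. -}

module Defs where

open import Data.Nat as ℕ using (ℕ; zero; suc; NonZero)
import Data.Nat.Properties as ℕP
open import Data.Nat.Divisibility using (_∣_; _∣?_)
open import Data.Nat.Primality using (Prime; prime?)
open import Data.Integer as ℤ using (ℤ; +_; _%ℕ_)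
open import Data.List using (List; filter; upTo; cartesianProduct; map; foldr)
open import Data.List.Relation.Unary.Any using (any?)
open import Data.Product using (_×_; _,_; proj₁; proj₂)
open import Relation.Nullary using (¬_; yes; no; _×-dec_)
open import Relation.Binary.PropositionalEquality using (_≡_)

SquareFree : ℕ → Set
SquareFree n = ∀ p → Prime p → ¬ (p ℕ.* p ∣ n)

Odd : ℕ → Set
Odd n = ¬ (2 ∣ n)

sumℤ : List ℤ → ℤ
sumℤ = foldr ℤ._+_ (+ 0)

prodℤ : List ℤ → ℤ
prodℤ = foldr ℤ._*_ (+ 1)

-- Legendre symbol (x / p): 0 if p ∣ x, 1 if x is a nonzero square mod p,
-- -1 otherwise.  (Only used for odd primes p; value at p = 0 is irrelevant.)
legendre : ℤ → ℕ → ℤ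
legendre x zero = + 0
legendre x p@(suc _) with (x %ℕ p) ℕ.≟ 0
... | yes _ = + 0
... | no _ with any? (λ y → ((y ℕ.* y) ℕ.% p) ℕ.≟ (x %ℕ p)) (upTo p)
...   | yes _ = + 1
...   | no _  = ℤ.-[1+ 0 ]

-- The list of primes dividing n (for n ≥ 1 these all lie in [0, n]).
primeDivisors : ℕ → List ℕ
primeDivisors n = filter (λ p → prime? p ×-dec (p ∣? n)) (upTo (suc n))

-- Ordered pairs (a , b) of positive integers with a * b = D
-- (for D ≥ 1 these all lie in [0, D] × [0, D]).
factorPairs : ℕ → List (ℕ × ℕ)
factorPairs D =
  filter (λ ab → proj₁ ab ℕ.* proj₂ ab ℕ.≟ D)
    (cartesianProduct (upTo (suc D)) (upTo (suc D)))

S : ℕ → ℤ → ℤ → ℤ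
S D u v = sumℤ (map term (factorPairs D))
  where
  term : ℕ × ℕ → ℤ
  term (a , b) =
    prodℤ (map (λ p → + 1 ℤ.+ legendre (u ℤ.* + a) p) (primeDivisors b))
    ℤ.* prodℤ (map (λ p → + 1 ℤ.+ legendre (v ℤ.* + b) p) (primeDivisors a))

-- For u a unit modulo D, the summand of S_D(u,u) at a factor pair (a, b) is a
-- product of factors 1 + (±1), hence 0 or 2^ω(D); it is nonzero exactly when
-- (a, b) is "u-good": u a is a quadratic residue modulo every prime of b and
-- u b modulo every prime of a.  So S_D(1,1) > 0, since (D, 1) is 1-good.
-- For S_D(2,2) either every summand vanishes, or some pair (a₀, b₀) is 2-good.
-- In the latter case the reflection σ(a, b) = (Δ a a₀, Δ b a₀), where
-- Δ x y = x y / gcd(x,y)², is an involution of the factor pairs, and a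
-- composition law for goodness (residues multiply, unit squares cancel) shows
-- that x is 1-good iff σ x is 2-good.  Thus σ carries the summands of
-- S_D(2,2) onto those of S_D(1,1).

module Submission where

open import Defs
open import Algebra.Bundles using (CommutativeMonoid)
import Data.Nat.Properties as ℕP
open import Algebra.Properties.CommutativeSemigroup ℕP.*-commutativeSemigroup
  using (interchange; xy∙z≈xz∙y; x∙yz≈y∙xz)
open import Data.Nat as ℕ using (ℕ; suc; NonZero; _*_; _+_; _^_; _>_; s≤s; ≢-nonZero)
open import Data.Nat.DivMod using (_%_; %-distribˡ-*; m%n<n; m%n%n≡m%n; [m+kn]%n≡m%n; %-remove-+ˡ; %-remove-+ʳ)
open import Data.Nat.Divisibility
  using (_∣_; _∣?_; divides; ∣-trans; ∣-refl; ∣-reflexive; ∣-antisym; m∣m*n; n∣m*n; ∣⇒≤; ∣1⇒≡1; 0∣⇒≡0; *-pres-∣; *-monoˡ-∣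
        ; ∣m⇒∣m*n; ∣n⇒∣m*n; m%n≡0⇒n∣m; n∣m⇒m%n≡0)
open import Data.Nat.Primality
  using (Prime; prime?; prime⇒nonZero; prime⇒irreducible; euclidsLemma; ¬prime[1]; irreducible[2])
open import Data.Nat.Primality.Factorisation using (factorise)
open import Data.Nat.Coprimality using (Coprime; coprime-Bézout; coprime-divisor; gcd≡1⇒coprime; coprime⇒gcd≡1)
import Data.Nat.Coprimality as Coprimality
open import Data.Nat.GCD
  using (gcd; gcd[m,n]∣m; gcd[m,n]∣n; gcd-greatest; gcd[m,n]≢0; c*gcd[m,n]≡gcd[cm,cn]; gcd-comm; module Bézout)
open import Data.Nat.ListAction using (product)
import Data.Nat.Tactic.RingSolver as NatSolver
open import Data.Integer as ℤ using (ℤ; +_; -[1+_]; +<+)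
import Data.Integer.Properties as ℤP
open import Data.List using (List; []; _∷_; _++_; map; length; upTo; cartesianProduct)
import Data.List.Properties as List
open import Data.List.Relation.Unary.All as All using (_∷_)
open import Data.List.Relation.Unary.Any using (any?; here; there)
open import Data.List.Relation.Unary.Unique.Propositional using (Unique)
import Data.List.Relation.Unary.Unique.Propositional.Properties as Unique
open import Data.List.Membership.Propositional using (_∈_; lose; find)
open import Data.List.Membership.Propositional.Properties
  using (∈-map⁺; ∈-map⁻; ∈-filter⁺; ∈-filter⁻; ∈-upTo⁺; ∈-cartesianProduct⁺; ∈-++⁺ˡ; ∈-++⁺ʳ; ∈-++⁻)
open import Data.List.Membership.Propositional.Properties.WithK using (unique∧set⇒bag)
open import Data.List.Relation.Binary.BagAndSetEquality using (∼bag⇒↭)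
open import Data.List.Relation.Binary.Permutation.Propositional using (_↭_; ↭-sym; ↭⇒↭ₛ)
open import Data.List.Relation.Binary.Permutation.Propositional.Properties using (↭-length; map⁺)
open import Data.List.Relation.Binary.Permutation.Setoid.Properties using (foldr-commMonoid)
open import Data.Product using (∃-syntax; _×_; _,_; proj₁; proj₂)
open import Data.Sum using (_⊎_; inj₁; inj₂; [_,_])
open import Function using (_∘_)
open import Function.Bundles using (mk⇔)
open import Relation.Nullary using (¬_; yes; no; contradiction; _×-dec_)
open import Relation.Binary.PropositionalEquality
  using (_≡_; _≢_; refl; sym; trans; cong; cong₂; subst; subst₂; module ≡-Reasoning)

prime∤1 : ∀ {p} → Prime p → ¬ p ∣ 1
prime∤1 pr p∣1 = ¬prime[1] (subst Prime (∣1⇒≡1 p∣1) pr)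

prime∤* : ∀ {p x y} → Prime p → ¬ p ∣ x → ¬ p ∣ y → ¬ p ∣ x * y
prime∤* {x = x} {y} pr p∤x p∤y p∣xy = [ p∤x , p∤y ] (euclidsLemma x y pr p∣xy)

euclidˡ : ∀ {p m n} → Prime p → p ∣ m * n → ¬ p ∣ n → p ∣ m
euclidˡ {m = m} {n} pr p∣mn p∤n = [ (λ p∣m → p∣m) , (λ p∣n → contradiction p∣n p∤n) ] (euclidsLemma m n pr p∣mn)

euclidʳ : ∀ {p m n} → Prime p → p ∣ m * n → ¬ p ∣ m → p ∣ n
euclidʳ {m = m} {n} pr p∣mn p∤m = [ (λ p∣m → contradiction p∣m p∤m) , (λ p∣n → p∣n) ] (euclidsLemma m n pr p∣mn)

prime∤⇒coprime : ∀ {p n} → Prime p → ¬ p ∣ n → Coprime p n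
prime∤⇒coprime pr p∤n (d∣p , d∣n) with prime⇒irreducible pr d∣p
... | inj₁ d≡1 = d≡1
... | inj₂ refl = contradiction d∣n p∤n

coprime⇒¬common-prime : ∀ {p a b} → Coprime a b → Prime p → p ∣ a → ¬ p ∣ b
coprime⇒¬common-prime cop pr p∣a p∣b = ¬prime[1] (subst Prime (cop (p∣a , p∣b)) pr)

*-cancelʳ : ∀ m n {o} → o ≢ 0 → m * o ≡ n * o → m ≡ n
*-cancelʳ m n {o} o≢0 = ℕP.*-cancelʳ-≡ m n o {{≢-nonZero o≢0}}

divisor≢0 : ∀ {d n} → d ∣ n → n ≢ 0 → d ≢ 0
divisor≢0 d∣n n≢0 refl = n≢0 (0∣⇒≡0 d∣n)

prime-factor : ∀ {n} → n ≢ 0 → n ≢ 1 → ∃[ r ] Prime r × r ∣ n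
prime-factor {n} n≢0 n≢1 with factorise n {{≢-nonZero n≢0}}
... | record { factors = [] ; isFactorisation = n≡1 } = contradiction n≡1 n≢1
... | record { factors = r ∷ rs ; isFactorisation = n≡r*rs ; factorsPrime = r-prime ∷ _ } =
  r , r-prime , divides (product rs) (trans n≡r*rs (ℕP.*-comm r (product rs)))

squarefree-∣ : ∀ {m n} → m ∣ n → SquareFree n → SquareFree m
squarefree-∣ m∣n sf r r-prime rr∣m = sf r r-prime (∣-trans rr∣m m∣n)

-- Complementary divisors a, b of a squarefree n (a b ∣ n) are coprime:
-- a common prime factor r would give r² ∣ n.
squarefree-coprime : ∀ {n a b} → SquareFree n → n ≢ 0 → a * b ∣ n → Coprime a b
squarefree-coprime {n} {a} {b} sf n≢0 ab∣n {d} (d∣a , d∣b) with d ℕ.≟ 1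
... | yes d≡1 = d≡1
... | no d≢1 =
  let r , r-prime , r∣d = prime-factor (divisor≢0 d∣n n≢0) d≢1
  in contradiction (∣-trans (*-pres-∣ (∣-trans r∣d d∣a) (∣-trans r∣d d∣b)) ab∣n) (sf r r-prime)
  where
  d∣n : d ∣ n
  d∣n = ∣-trans d∣a (∣-trans (∣m⇒∣m*n b ∣-refl) ab∣n)

%-*-cong : ∀ {p x y u v} .{{_ : NonZero p}} →
  x % p ≡ y % p → u % p ≡ v % p → (x * u) % p ≡ (y * v) % p
%-*-cong {p} {x} {y} {u} {v} x≡y u≡v = begin
  (x * u) % p               ≡⟨ %-distribˡ-* x u p ⟩
  ((x % p) * (u % p)) % p   ≡⟨ cong₂ (λ s t → (s * t) % p) x≡y u≡v ⟩
  ((y % p) * (v % p)) % p   ≡⟨ %-distribˡ-* y v p ⟨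
  (y * v) % p               ∎
  where open ≡-Reasoning

Residue : ℕ → ℕ → Set
Residue p x = legendre (+ x) p ≡ + 1

residue-intro : ∀ {p x} .{{_ : NonZero p}} (y : ℕ) → ¬ p ∣ x → (y * y) % p ≡ x % p → Residue p x
residue-intro {p@(suc _)} {x} y p∤x y²≡x with x % p ℕ.≟ 0
... | yes x≡0 = contradiction (m%n≡0⇒n∣m x p x≡0) p∤x
... | no _ with any? (λ z → ((z * z) % p) ℕ.≟ (x % p)) (upTo p)
...   | yes _ = refl
...   | no none = contradiction (lose (∈-upTo⁺ (m%n<n y p)) reduced) none
  where
  reduced : ((y % p) * (y % p)) % p ≡ x % p
  reduced = trans (%-*-cong {x = y % p} {y} {y % p} {y} (m%n%n≡m%n y p) (m%n%n≡m%n y p)) y²≡x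

residue-elim : ∀ {p x} .{{_ : NonZero p}} → Residue p x → ¬ p ∣ x × ∃[ y ] (y * y) % p ≡ x % p
residue-elim {p@(suc _)} {x} res with x % p ℕ.≟ 0
residue-elim {p@(suc _)} {x} () | yes _
... | no x≢0 with any? (λ z → ((z * z) % p) ℕ.≟ (x % p)) (upTo p)
residue-elim {p@(suc _)} {x} () | no _ | no _
... | yes square with find square
...   | y , _ , y²≡x = (λ p∣x → x≢0 (n∣m⇒m%n≡0 x p p∣x)) , y , y²≡x

residue⇒∤ : ∀ {p x} → Prime p → Residue p x → ¬ p ∣ x
residue⇒∤ pr res = proj₁ (residue-elim {{prime⇒nonZero pr}} res)

legendre-unit : ∀ {p x} .{{_ : NonZero p}} → ¬ p ∣ x →
  Residue p x ⊎ legendre (+ x) p ≡ -[1+ 0 ]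
legendre-unit {p@(suc _)} {x} p∤x with x % p ℕ.≟ 0
... | yes x≡0 = contradiction (m%n≡0⇒n∣m x p x≡0) p∤x
... | no _ with any? (λ z → ((z * z) % p) ℕ.≟ (x % p)) (upTo p)
...   | yes _ = inj₁ refl
...   | no _ = inj₂ refl

residue-one : ∀ {p} → Prime p → Residue p 1
residue-one {p} pr = residue-intro 1 (prime∤1 pr) refl
  where instance _ = prime⇒nonZero pr

residue-* : ∀ {p x y} → Prime p → Residue p x → Residue p y → Residue p (x * y)
residue-* {p} {x} {y} pr rx ry =
  let instance _ = prime⇒nonZero pr
      p∤x , a , a²≡x = residue-elim rx
      p∤y , b , b²≡y = residue-elim ry
      open ≡-Reasoning
  in residue-intro (a * b) (prime∤* pr p∤x p∤y) (begin
    ((a * b) * (a * b)) % p   ≡⟨ cong (_% p) (interchange a b a b) ⟩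
    ((a * a) * (b * b)) % p   ≡⟨ %-*-cong {x = a * a} {x} {b * b} {y} a²≡x b²≡y ⟩
    (x * y) % p               ∎)

-- If p divides k + 1 then k is -1 mod p, so k² ≡ 1 (mod p).
minus-one-square : ∀ {p} .{{_ : NonZero p}} k → p ∣ suc k → (k * k) % p ≡ 1 % p
minus-one-square {p} k p∣k+1 = begin
  (k * k) % p                             ≡⟨ %-remove-+ʳ (k * k) (∣n⇒∣m*n 2 p∣k+1) ⟨
  (k * k + 2 * suc k) % p                 ≡⟨ cong (_% p) (expand k) ⟩
  (suc k * suc k + 1) % p                 ≡⟨ %-remove-+ˡ 1 (∣m⇒∣m*n (suc k) p∣k+1) ⟩
  1 % p                                   ∎
  where
  open ≡-Reasoning
  expand : ∀ k → k * k + 2 * suc k ≡ suc k * suc k + 1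
  expand = NatSolver.solve-∀

-- A unit g mod p is invertible up to sign: some w has (w g)² ≡ 1 (mod p).
-- (Bézout gives w g ≡ ±1; the sign disappears on squaring.)
square-inverse : ∀ {p g} .{{_ : NonZero p}} → Prime p → ¬ p ∣ g →
  ∃[ w ] ((w * g) * (w * g)) % p ≡ 1 % p
square-inverse {p} {g} pr p∤g with coprime-Bézout (prime∤⇒coprime pr p∤g)
... | Bézout.+- x w 1+wg≡xp = w , minus-one-square (w * g) (divides x 1+wg≡xp)
... | Bézout.-+ x w 1+xp≡wg = w , %-*-cong {x = w * g} {1} {w * g} {1} wg≡1 wg≡1
  where
  wg≡1 : (w * g) % p ≡ 1 % p
  wg≡1 = trans (cong (_% p) (sym 1+xp≡wg)) ([m+kn]%n≡m%n 1 x p)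

residue-cancel : ∀ {p g m} → Prime p → ¬ p ∣ g → Residue p ((g * g) * m) → Residue p m
residue-cancel {p} {g} {m} pr p∤g res =
  let instance _ = prime⇒nonZero pr
      p∤g²m , b , b²≡g²m = residue-elim res
      w , [wg]²≡1 = square-inverse pr p∤g
      open ≡-Reasoning
  in residue-intro (w * b) (λ p∣m → p∤g²m (∣n⇒∣m*n (g * g) p∣m)) (begin
    ((w * b) * (w * b)) % p          ≡⟨ cong (_% p) (interchange w b w b) ⟩
    ((w * w) * (b * b)) % p          ≡⟨ %-*-cong {x = w * w} {w * w} {b * b} {(g * g) * m} refl b²≡g²m ⟩
    ((w * w) * ((g * g) * m)) % p    ≡⟨ cong (_% p) (regroup w g m) ⟩
    (((w * g) * (w * g)) * m) % p    ≡⟨ %-*-cong {x = (w * g) * (w * g)} {1} {m} {m} [wg]²≡1 refl ⟩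
    (1 * m) % p                      ≡⟨ cong (_% p) (ℕP.*-identityˡ m) ⟩
    m % p                            ∎)
  where
  regroup : ∀ w g m → (w * w) * ((g * g) * m) ≡ ((w * g) * (w * g)) * m
  regroup = NatSolver.solve-∀

-- For squarefree x, y, Δ x y is the product of the primes dividing exactly
-- one of x and y ("symmetric difference" of their prime sets).
cofactorˡ cofactorʳ Δ : ℕ → ℕ → ℕ
cofactorˡ x y = _∣_.quotient (gcd[m,n]∣m x y)
cofactorʳ x y = _∣_.quotient (gcd[m,n]∣n x y)
Δ x y = cofactorˡ x y * cofactorʳ x y

cofactorˡ-spec : ∀ x y → x ≡ cofactorˡ x y * gcd x y
cofactorˡ-spec x y = _∣_.equality (gcd[m,n]∣m x y)

cofactorʳ-spec : ∀ x y → y ≡ cofactorʳ x y * gcd x y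
cofactorʳ-spec x y = _∣_.equality (gcd[m,n]∣n x y)

Δ-spec : ∀ x y → Δ x y * (gcd x y * gcd x y) ≡ x * y
Δ-spec x y = trans (interchange (cofactorˡ x y) (cofactorʳ x y) (gcd x y) (gcd x y))
                   (sym (cong₂ _*_ (cofactorˡ-spec x y) (cofactorʳ-spec x y)))

Δ∣* : ∀ x y → Δ x y ∣ x * y
Δ∣* x y = divides (gcd x y * gcd x y) (trans (sym (Δ-spec x y)) (ℕP.*-comm (Δ x y) _))

-- A common factor t of x = k t and y = l t with k, l coprime is their gcd,
-- so k and l are the cofactors and Δ x y = k l.
Δ-unique : ∀ {x y k l t} → t ≢ 0 → x ≡ k * t → y ≡ l * t → Coprime k l → Δ x y ≡ k * l
Δ-unique {x} {y} {k} {l} {t} t≢0 x≡kt y≡lt cop =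
  cong₂ _*_ (cancel (cofactorˡ x y) k (cofactorˡ-spec x y) x≡kt)
            (cancel (cofactorʳ x y) l (cofactorʳ-spec x y) y≡lt)
  where
  open ≡-Reasoning
  gcd≡t : gcd x y ≡ t
  gcd≡t = begin
    gcd x y                ≡⟨ cong₂ gcd (trans x≡kt (ℕP.*-comm k t)) (trans y≡lt (ℕP.*-comm l t)) ⟩
    gcd (t * k) (t * l)    ≡⟨ c*gcd[m,n]≡gcd[cm,cn] t k l ⟨
    t * gcd k l            ≡⟨ cong (t *_) (coprime⇒gcd≡1 cop) ⟩
    t * 1                  ≡⟨ ℕP.*-identityʳ t ⟩
    t                      ∎
  cancel : ∀ {z} c c′ → z ≡ c * gcd x y → z ≡ c′ * t → c ≡ c′
  cancel c c′ z≡cg z≡c′t = *-cancelʳ c c′ t≢0 (trans (cong (c *_) (sym gcd≡t)) (trans (sym z≡cg) z≡c′t))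

cofactors-coprime : ∀ {x y} → x ≢ 0 → Coprime (cofactorˡ x y) (cofactorʳ x y)
cofactors-coprime {x} {y} x≢0 = gcd≡1⇒coprime (ℕP.*-cancelˡ-≡ _ 1 g {{≢-nonZero g≢0}} (begin
  g * gcd (cofactorˡ x y) (cofactorʳ x y)              ≡⟨ c*gcd[m,n]≡gcd[cm,cn] g _ _ ⟩
  gcd (g * cofactorˡ x y) (g * cofactorʳ x y)          ≡⟨ cong₂ gcd (swap (cofactorˡ-spec x y)) (swap (cofactorʳ-spec x y)) ⟩
  gcd x y                                              ≡⟨ ℕP.*-identityʳ g ⟨
  g * 1                                                ∎))
  where
  open ≡-Reasoning
  g : ℕ
  g = gcd x y
  g≢0 : g ≢ 0
  g≢0 = gcd[m,n]≢0 x y (inj₁ x≢0)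
  swap : ∀ {z c} → z ≡ c * g → g * c ≡ z
  swap {z} {c} z≡cg = trans (ℕP.*-comm g c) (sym z≡cg)

-- If a b = c d then Δ a c = Δ b d.  Writing a = a′g, c = c′g with g = gcd a c,
-- coprimality of the cofactors forces b = c′t and d = a′t.
Δ-swap : ∀ {a b c d} → a ≢ 0 → b ≢ 0 → a * b ≡ c * d → Δ a c ≡ Δ b d
Δ-swap {a} {b} {c} {d} a≢0 b≢0 ab≡cd =
  trans (ℕP.*-comm a′ c′) (sym (Δ-unique t≢0 b≡c′t d≡a′t (Coprimality.sym cop)))
  where
  open ≡-Reasoning
  g a′ c′ : ℕ
  g = gcd a c
  a′ = cofactorˡ a c
  c′ = cofactorʳ a c
  cop : Coprime a′ c′
  cop = cofactors-coprime a≢0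
  a′b≡c′d : a′ * b ≡ c′ * d
  a′b≡c′d = *-cancelʳ (a′ * b) (c′ * d) (gcd[m,n]≢0 a c (inj₁ a≢0)) (begin
    a′ * b * g     ≡⟨ xy∙z≈xz∙y a′ b g ⟩
    a′ * g * b     ≡⟨ cong (_* b) (cofactorˡ-spec a c) ⟨
    a * b          ≡⟨ ab≡cd ⟩
    c * d          ≡⟨ cong (_* d) (cofactorʳ-spec a c) ⟩
    c′ * g * d     ≡⟨ xy∙z≈xz∙y c′ g d ⟩
    c′ * d * g     ∎)
  c′∣b : c′ ∣ b
  c′∣b = coprime-divisor (Coprimality.sym cop) (divides d (trans a′b≡c′d (ℕP.*-comm c′ d)))
  t : ℕ
  t = _∣_.quotient c′∣b
  b≡c′t : b ≡ c′ * t
  b≡c′t = trans (_∣_.equality c′∣b) (ℕP.*-comm t c′)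
  t≢0 : t ≢ 0
  t≢0 t≡0 = b≢0 (trans (_∣_.equality c′∣b) (cong (_* c′) t≡0))
  c′≢0 : c′ ≢ 0
  c′≢0 = divisor≢0 c′∣b b≢0
  d≡a′t : d ≡ a′ * t
  d≡a′t = ℕP.*-cancelˡ-≡ d (a′ * t) c′ {{≢-nonZero c′≢0}} (begin
    c′ * d         ≡⟨ a′b≡c′d ⟨
    a′ * b         ≡⟨ cong (a′ *_) b≡c′t ⟩
    a′ * (c′ * t)  ≡⟨ x∙yz≈y∙xz a′ c′ t ⟩
    c′ * (a′ * t)  ∎)

-- For squarefree x, Δ (Δ x y) y = x (symmetric difference with y is an involution).
Δ-involutive : ∀ {x y} → SquareFree x → x ≢ 0 → y ≢ 0 → Δ (Δ x y) y ≡ x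
Δ-involutive {x} {y} sf x≢0 y≢0 = trans (Δ-unique y′≢0 refl y≡gy′ cop) (sym (cofactorˡ-spec x y))
  where
  g y′ : ℕ
  g = gcd x y
  y′ = cofactorʳ x y
  y≡gy′ : y ≡ g * y′
  y≡gy′ = trans (cofactorʳ-spec x y) (ℕP.*-comm y′ g)
  y′≢0 : y′ ≢ 0
  y′≢0 y′≡0 = y≢0 (trans (cofactorʳ-spec x y) (cong (_* g) y′≡0))
  cop : Coprime (cofactorˡ x y) g
  cop = squarefree-coprime sf x≢0 (∣-reflexive (sym (cofactorˡ-spec x y)))

gcd-split : ∀ {a b c} → Coprime a b → c ≢ 0 → c ∣ a * b → gcd a c * gcd b c ≡ c
gcd-split {a} {b} {c} cop c≢0 c∣ab =
  subst₂ (λ g₁ g₂ → g₁ * g₂ ≡ c) (gcd-comm c a) (gcd-comm c b) (∣-antisym g₁g₂∣c c∣g₁g₂)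
  where
  g₁ g₂ : ℕ
  g₁ = gcd c a
  g₂ = gcd c b
  -- g₁ g₂ ∣ c: writing c = k g₁, the factor g₂ (coprime to g₁) divides k.
  k : ℕ
  k = _∣_.quotient (gcd[m,n]∣m c a)
  c≡kg₁ : c ≡ k * g₁
  c≡kg₁ = _∣_.equality (gcd[m,n]∣m c a)
  g₂∣k : g₂ ∣ k
  g₂∣k = coprime-divisor cop₂₁ (subst (g₂ ∣_) (trans c≡kg₁ (ℕP.*-comm k g₁)) (gcd[m,n]∣m c b))
    where
    cop₂₁ : Coprime g₂ g₁
    cop₂₁ (d∣g₂ , d∣g₁) = cop (∣-trans d∣g₁ (gcd[m,n]∣n c a) , ∣-trans d∣g₂ (gcd[m,n]∣n c b))
  g₁g₂∣c : g₁ * g₂ ∣ c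
  g₁g₂∣c = subst₂ _∣_ (ℕP.*-comm g₂ g₁) (sym c≡kg₁) (*-monoˡ-∣ g₁ g₂∣k)
  -- c ∣ g₁ g₂: writing c = c′ g₁, a = a′ g₁, the cofactor c′ divides b, hence g₂.
  c′ a′ : ℕ
  c′ = cofactorˡ c a
  a′ = cofactorʳ c a
  c′∣b : c′ ∣ b
  c′∣b = coprime-divisor (cofactors-coprime c≢0) (divides m (*-cancelʳ (a′ * b) (m * c′)
          (gcd[m,n]≢0 c a (inj₁ c≢0)) (begin
    a′ * b * g₁     ≡⟨ xy∙z≈xz∙y a′ b g₁ ⟩
    a′ * g₁ * b     ≡⟨ cong (_* b) (cofactorʳ-spec c a) ⟨
    a * b           ≡⟨ ab≡mc ⟩
    m * c           ≡⟨ cong (m *_) (cofactorˡ-spec c a) ⟩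
    m * (c′ * g₁)   ≡⟨ ℕP.*-assoc m c′ g₁ ⟨
    m * c′ * g₁     ∎)))
    where
    open ≡-Reasoning
    m : ℕ
    m = _∣_.quotient c∣ab
    ab≡mc : a * b ≡ m * c
    ab≡mc = _∣_.equality c∣ab
  c′∣g₂ : c′ ∣ g₂
  c′∣g₂ = gcd-greatest (subst (c′ ∣_) (sym (cofactorˡ-spec c a)) (m∣m*n g₁)) c′∣b
  c∣g₁g₂ : c ∣ g₁ * g₂
  c∣g₁g₂ = subst₂ _∣_ (sym (cofactorˡ-spec c a)) (ℕP.*-comm g₂ g₁) (*-monoˡ-∣ g₁ c′∣g₂)

Δ-factor-pair : ∀ {D a b a₀ b₀} → SquareFree D → D ≢ 0 → a * b ≡ D → a₀ * b₀ ≡ D →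
  Δ a a₀ * Δ b a₀ ≡ D
Δ-factor-pair {D} {a} {b} {a₀} {b₀} sf D≢0 ab≡D a₀b₀≡D =
  *-cancelʳ (Δ a a₀ * Δ b a₀) D (λ a₀²≡0 → [ a₀≢0 , a₀≢0 ] (ℕP.m*n≡0⇒m≡0∨n≡0 a₀ a₀²≡0)) (begin
    Δ a a₀ * Δ b a₀ * (a₀ * a₀)                        ≡⟨ cong (λ z → Δ a a₀ * Δ b a₀ * (z * z)) g₁g₂≡a₀ ⟨
    Δ a a₀ * Δ b a₀ * ((g₁ * g₂) * (g₁ * g₂))          ≡⟨ regroup (Δ a a₀) (Δ b a₀) g₁ g₂ ⟩
    (Δ a a₀ * (g₁ * g₁)) * (Δ b a₀ * (g₂ * g₂))        ≡⟨ cong₂ _*_ (Δ-spec a a₀) (Δ-spec b a₀) ⟩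
    (a * a₀) * (b * a₀)                                ≡⟨ interchange a a₀ b a₀ ⟩
    (a * b) * (a₀ * a₀)                                ≡⟨ cong (_* (a₀ * a₀)) ab≡D ⟩
    D * (a₀ * a₀)                                      ∎)
  where
  open ≡-Reasoning
  g₁ g₂ : ℕ
  g₁ = gcd a a₀
  g₂ = gcd b a₀
  a₀≢0 : a₀ ≢ 0
  a₀≢0 a₀≡0 = D≢0 (trans (sym a₀b₀≡D) (cong (_* b₀) a₀≡0))
  g₁g₂≡a₀ : g₁ * g₂ ≡ a₀
  g₁g₂≡a₀ = gcd-split {a} {b} (squarefree-coprime sf D≢0 (∣-reflexive ab≡D)) a₀≢0
              (subst (a₀ ∣_) (trans a₀b₀≡D (sym ab≡D)) (m∣m*n b₀))
  regroup : ∀ A B g h → A * B * ((g * h) * (g * h)) ≡ (A * (g * g)) * (B * (h * h))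
  regroup = NatSolver.solve-∀

unique-↭ : ∀ {A : Set} {xs ys : List A} → Unique xs → Unique ys →
  (∀ {x} → x ∈ xs → x ∈ ys) → (∀ {x} → x ∈ ys → x ∈ xs) → xs ↭ ys
unique-↭ xs! ys! xs⊆ys ys⊆xs = ∼bag⇒↭ (unique∧set⇒bag xs! ys! (mk⇔ xs⊆ys ys⊆xs))

involution-↭ : ∀ {A : Set} {f : A → A} {xs : List A} → Unique xs →
  (∀ {x} → x ∈ xs → f x ∈ xs) → (∀ {x} → x ∈ xs → f (f x) ≡ x) → map f xs ↭ xs
involution-↭ {f = f} {xs} xs! f-closed f-invol =
  unique-↭ fxs! xs! image⊆xs (λ x∈ → subst (_∈ map f xs) (f-invol x∈) (∈-map⁺ f (f-closed x∈)))
  where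
  ffxs≡xs : map f (map f xs) ≡ xs
  ffxs≡xs = trans (sym (List.map-∘ xs)) (trans (List.map-cong-local (All.tabulate f-invol)) (List.map-id xs))
  fxs! : Unique (map f xs)
  fxs! = Unique.map⁻ (subst Unique (sym ffxs≡xs) xs!)
  image⊆xs : ∀ {y} → y ∈ map f xs → y ∈ xs
  image⊆xs y∈ with ∈-map⁻ f y∈
  ... | x , x∈ , refl = f-closed x∈

sumℤ-↭ : ∀ {xs ys} → xs ↭ ys → sumℤ xs ≡ sumℤ ys
sumℤ-↭ p = foldr-commMonoid ℤ+.setoid ℤ+.isCommutativeMonoid (↭⇒↭ₛ p)
  where module ℤ+ = CommutativeMonoid ℤP.+-0-commutativeMonoid

module _ {A : Set} (f : A → ℤ) where

  sumℤ-nonneg : ∀ xs → (∀ {x} → x ∈ xs → + 0 ℤ.≤ f x) → + 0 ℤ.≤ sumℤ (map f xs)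
  sumℤ-nonneg [] _ = ℤP.≤-refl
  sumℤ-nonneg (x ∷ xs) nonneg = ℤP.+-mono-≤ (nonneg (here refl)) (sumℤ-nonneg xs (nonneg ∘ there))

  sumℤ-pos : ∀ xs → (∀ {x} → x ∈ xs → + 0 ℤ.≤ f x) → ∀ {y} → y ∈ xs → + 0 ℤ.< f y →
    + 0 ℤ.< sumℤ (map f xs)
  sumℤ-pos (x ∷ xs) nonneg (here refl) pos = ℤP.+-mono-<-≤ pos (sumℤ-nonneg xs (nonneg ∘ there))
  sumℤ-pos (x ∷ xs) nonneg (there y∈) pos = ℤP.+-mono-≤-< (nonneg (here refl)) (sumℤ-pos xs (nonneg ∘ there) y∈ pos)

  sumℤ≢0⇒term≢0 : ∀ xs → sumℤ (map f xs) ≢ + 0 → ∃[ x ] x ∈ xs × f x ≢ + 0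
  sumℤ≢0⇒term≢0 [] sum≢0 = contradiction refl sum≢0
  sumℤ≢0⇒term≢0 (x ∷ xs) sum≢0 with f x ℤ.≟ + 0
  ... | no fx≢0 = x , here refl , fx≢0
  ... | yes fx≡0 with sumℤ≢0⇒term≢0 xs (λ rest≡0 → sum≢0 (cong₂ ℤ._+_ fx≡0 rest≡0))
  ...   | y , y∈ , fy≢0 = y , there y∈ , fy≢0

module _ {A : Set} (ε : A → ℤ) where

  prodℤ-twos : ∀ xs → (∀ {x} → x ∈ xs → ε x ≡ + 1) →
    prodℤ (map (λ x → + 1 ℤ.+ ε x) xs) ≡ + (2 ^ length xs)
  prodℤ-twos [] _ = refl
  prodℤ-twos (x ∷ xs) ones = begin
    (+ 1 ℤ.+ ε x) ℤ.* prodℤ (map (λ x → + 1 ℤ.+ ε x) xs)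
      ≡⟨ cong₂ ℤ._*_ (cong (ℤ._+_ (+ 1)) (ones (here refl))) (prodℤ-twos xs (ones ∘ there)) ⟩
    + 2 ℤ.* + (2 ^ length xs)
      ≡⟨ ℤP.pos-* 2 (2 ^ length xs) ⟨
    + (2 ^ length (x ∷ xs))
      ∎
    where open ≡-Reasoning

  prodℤ≢0⇒ones : ∀ xs → (∀ {x} → x ∈ xs → ε x ≡ + 1 ⊎ ε x ≡ -[1+ 0 ]) →
    prodℤ (map (λ x → + 1 ℤ.+ ε x) xs) ≢ + 0 → ∀ {x} → x ∈ xs → ε x ≡ + 1
  prodℤ≢0⇒ones (x ∷ xs) signs prod≢0 (here refl) with signs (here refl)
  ... | inj₁ εx≡1 = εx≡1
  ... | inj₂ εx≡-1 = contradiction (cong (λ e → (+ 1 ℤ.+ e) ℤ.* prodℤ (map (λ x → + 1 ℤ.+ ε x) xs)) εx≡-1) prod≢0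
  prodℤ≢0⇒ones (x ∷ xs) signs prod≢0 (there y∈) =
    prodℤ≢0⇒ones xs (signs ∘ there) rest≢0 y∈
    where
    rest≢0 : prodℤ (map (λ x → + 1 ℤ.+ ε x) xs) ≢ + 0
    rest≢0 rest≡0 = prod≢0 (trans (cong ((+ 1 ℤ.+ ε x) ℤ.*_) rest≡0) (ℤP.*-zeroʳ (+ 1 ℤ.+ ε x)))

∈-primeDivisors⁻ : ∀ {p n} → p ∈ primeDivisors n → Prime p × p ∣ n
∈-primeDivisors⁻ {n = n} p∈ = proj₂ (∈-filter⁻ (λ p → prime? p ×-dec (p ∣? n)) {xs = upTo (suc n)} p∈)

∈-primeDivisors⁺ : ∀ {p n} → n ≢ 0 → Prime p → p ∣ n → p ∈ primeDivisors n
∈-primeDivisors⁺ {n = n} n≢0 p-prime p∣n = ∈-filter⁺ (λ p → prime? p ×-dec (p ∣? n))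
  (∈-upTo⁺ (s≤s (∣⇒≤ {{≢-nonZero n≢0}} p∣n))) (p-prime , p∣n)

primeDivisors-unique : ∀ n → Unique (primeDivisors n)
primeDivisors-unique n = Unique.filter⁺ (λ p → prime? p ×-dec (p ∣? n)) (Unique.upTo⁺ (suc n))

ω : ℕ → ℕ
ω n = length (primeDivisors n)

-- ω is additive on coprime factors: their prime divisors partition those of the product.
ω-* : ∀ {a b} → Coprime a b → a ≢ 0 → b ≢ 0 → ω a + ω b ≡ ω (a * b)
ω-* {a} {b} cop a≢0 b≢0 = trans (sym (List.length-++ (primeDivisors a)))
  (↭-length (unique-↭ (Unique.++⁺ (primeDivisors-unique a) (primeDivisors-unique b) disjoint)
                      (primeDivisors-unique (a * b)) split⊆ ⊆split))
  where
  ab≢0 : a * b ≢ 0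
  ab≢0 ab≡0 = [ a≢0 , b≢0 ] (ℕP.m*n≡0⇒m≡0∨n≡0 a ab≡0)
  disjoint : ∀ {p} → ¬ (p ∈ primeDivisors a × p ∈ primeDivisors b)
  disjoint (p∈a , p∈b) with ∈-primeDivisors⁻ p∈a | ∈-primeDivisors⁻ p∈b
  ... | p-prime , p∣a | _ , p∣b = coprime⇒¬common-prime cop p-prime p∣a p∣b
  split⊆ : ∀ {p} → p ∈ primeDivisors a ++ primeDivisors b → p ∈ primeDivisors (a * b)
  split⊆ p∈ with ∈-++⁻ (primeDivisors a) p∈
  ... | inj₁ p∈a = let p-prime , p∣a = ∈-primeDivisors⁻ {n = a} p∈a
                   in ∈-primeDivisors⁺ {n = a * b} ab≢0 p-prime (∣m⇒∣m*n b p∣a)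
  ... | inj₂ p∈b = let p-prime , p∣b = ∈-primeDivisors⁻ {n = b} p∈b
                   in ∈-primeDivisors⁺ {n = a * b} ab≢0 p-prime (∣n⇒∣m*n a p∣b)
  ⊆split : ∀ {p} → p ∈ primeDivisors (a * b) → p ∈ primeDivisors a ++ primeDivisors b
  ⊆split p∈ with ∈-primeDivisors⁻ p∈
  ... | p-prime , p∣ab with euclidsLemma a b p-prime p∣ab
  ...   | inj₁ p∣a = ∈-++⁺ˡ (∈-primeDivisors⁺ a≢0 p-prime p∣a)
  ...   | inj₂ p∣b = ∈-++⁺ʳ (primeDivisors a) (∈-primeDivisors⁺ b≢0 p-prime p∣b)

legendreProduct : ℕ → ℕ → ℕ → ℤ
legendreProduct u a b = prodℤ (map (λ p → + 1 ℤ.+ legendre (+ (u * a)) p) (primeDivisors b))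

term : ℕ → ℕ × ℕ → ℤ
term u (a , b) = legendreProduct u a b ℤ.* legendreProduct u b a

-- S_D(u,u) is the sum of these summands (Defs multiplies u a in ℤ, we in ℕ).
S≡Σterm : ∀ D u → S D (+ u) (+ u) ≡ sumℤ (map (term u) (factorPairs D))
S≡Σterm D u = cong sumℤ (List.map-cong (λ (a , b) → cong₂ ℤ._*_ (at a b) (at b a)) (factorPairs D))
  where
  at : ∀ a b → prodℤ (map (λ p → + 1 ℤ.+ legendre (+ u ℤ.* + a) p) (primeDivisors b)) ≡ legendreProduct u a b
  at a b = cong prodℤ (List.map-cong (λ p → cong (λ z → + 1 ℤ.+ legendre z p) (sym (ℤP.pos-* u a))) (primeDivisors b))

-- (a, b) is u-good when u a is a residue modulo every prime factor of b and
-- u b is a residue modulo every prime factor of a: exactly the pairs whose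
-- summand does not vanish.
Good : ℕ → ℕ × ℕ → Set
Good u (a , b) = ∀ p → Prime p → (p ∣ b → Residue p (u * a)) × (p ∣ a → Residue p (u * b))

Good-swap : ∀ {u a b} → Good u (a , b) → Good u (b , a)
Good-swap good p pr = proj₂ (good p pr) , proj₁ (good p pr)

Unit : ℕ → ℕ → Set
Unit n u = ∀ p → Prime p → p ∣ n → ¬ p ∣ u

one-unit : ∀ n → Unit n 1
one-unit n p pr _ = prime∤1 pr

two-unit : ∀ {n} → Odd n → Unit n 2
two-unit odd p pr p∣n p∣2 with irreducible[2] p∣2
... | inj₁ refl = ¬prime[1] pr
... | inj₂ refl = odd p∣n

term-good : ∀ {u a b} → Good u (a , b) → term u (a , b) ≡ + (2 ^ (ω b + ω a))
term-good {u} {a} {b} good = begin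
  legendreProduct u a b ℤ.* legendreProduct u b a      ≡⟨ cong₂ ℤ._*_ (twos a b proj₁) (twos b a proj₂) ⟩
  + (2 ^ ω b) ℤ.* + (2 ^ ω a)                          ≡⟨ ℤP.pos-* (2 ^ ω b) (2 ^ ω a) ⟨
  + (2 ^ ω b * 2 ^ ω a)                                ≡⟨ cong +_ (ℕP.^-distribˡ-+-* 2 (ω b) (ω a)) ⟨
  + (2 ^ (ω b + ω a))                                  ∎
  where
  open ≡-Reasoning
  -- side selects the half of the goodness condition concerning the primes of y.
  twos : ∀ x y →
    (∀ {p} → (p ∣ b → Residue p (u * a)) × (p ∣ a → Residue p (u * b)) → p ∣ y → Residue p (u * x)) →
    legendreProduct u x y ≡ + (2 ^ ω y)
  twos x y side = prodℤ-twos (λ p → legendre (+ (u * x)) p) (primeDivisors y)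
    (λ p∈ → let p-prime , p∣y = ∈-primeDivisors⁻ p∈ in side (good _ p-prime) p∣y)

-- Conversely a nonzero summand forces goodness: for a coprime pair and a unit u,
-- each Legendre symbol is ±1, and a factor 1 + (-1) would kill the product.
term≢0⇒good : ∀ {u a b} → a ≢ 0 → b ≢ 0 → Coprime a b → Unit (a * b) u →
  term u (a , b) ≢ + 0 → Good u (a , b)
term≢0⇒good {u} {a} {b} a≢0 b≢0 cop u-unit term≢0 p pr =
    (λ p∣b → ones a b (Coprimality.sym cop) (∣n⇒∣m*n a) left≢0 (∈-primeDivisors⁺ b≢0 pr p∣b))
  , (λ p∣a → ones b a cop (∣m⇒∣m*n b) right≢0 (∈-primeDivisors⁺ a≢0 pr p∣a))
  where
  left≢0 : legendreProduct u a b ≢ + 0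
  left≢0 left≡0 = term≢0 (cong (ℤ._* legendreProduct u b a) left≡0)
  right≢0 : legendreProduct u b a ≢ + 0
  right≢0 right≡0 = term≢0 (trans (cong (legendreProduct u a b ℤ.*_) right≡0) (ℤP.*-zeroʳ (legendreProduct u a b)))
  ones : ∀ x y → Coprime y x → (∀ {q} → q ∣ y → q ∣ a * b) → legendreProduct u x y ≢ + 0 →
    ∀ {q} → q ∈ primeDivisors y → Residue q (u * x)
  ones x y cop-yx y∣ab prod≢0 = prodℤ≢0⇒ones (λ q → legendre (+ (u * x)) q) (primeDivisors y) signs prod≢0
    where
    signs : ∀ {q} → q ∈ primeDivisors y → Residue q (u * x) ⊎ legendre (+ (u * x)) q ≡ -[1+ 0 ]
    signs q∈ = let q-prime , q∣y = ∈-primeDivisors⁻ q∈ in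
      legendre-unit {{prime⇒nonZero q-prime}}
        (prime∤* q-prime (u-unit _ q-prime (y∣ab q∣y)) (coprime⇒¬common-prime cop-yx q-prime q∣y))

-- Since x y = Δ x y · gcd(x,y)², residues u x and v y give the residue (u v) Δ x y.
residue-Δ : ∀ {p u v x y} → Prime p → Residue p (u * x) → Residue p (v * y) →
  Residue p ((u * v) * Δ x y)
residue-Δ {p} {u} {v} {x} {y} pr res-ux res-vy =
  residue-cancel pr p∤g (subst (Residue p) regroup (residue-* pr res-ux res-vy))
  where
  open ≡-Reasoning
  g : ℕ
  g = gcd x y
  p∤g : ¬ p ∣ g
  p∤g p∣g = residue⇒∤ pr res-ux (∣n⇒∣m*n u (∣-trans p∣g (gcd[m,n]∣m x y)))
  rearrange : ∀ s d h → s * (d * (h * h)) ≡ (h * h) * (s * d)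
  rearrange = NatSolver.solve-∀
  regroup : (u * x) * (v * y) ≡ (g * g) * ((u * v) * Δ x y)
  regroup = begin
    (u * x) * (v * y)              ≡⟨ interchange u x v y ⟩
    (u * v) * (x * y)              ≡⟨ cong ((u * v) *_) (Δ-spec x y) ⟨
    (u * v) * (Δ x y * (g * g))    ≡⟨ rearrange (u * v) (Δ x y) g ⟩
    (g * g) * ((u * v) * Δ x y)    ∎

-- If a prime p divides Δ b a₀ then (u v) Δ a a₀ is a
-- residue mod p: either p ∤ a₀, so p divides b and b₀ and goodness applies to
-- u a and v a₀; or p ∣ a₀, so p divides a (as Δ b a₀ = Δ a b₀) and goodness
-- applies to u b and v b₀, using Δ a a₀ = Δ b b₀.
compose-residue : ∀ {p u v a b a₀ b₀} → Prime p → a ≢ 0 → b ≢ 0 → a * b ≡ a₀ * b₀ →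
  Coprime a₀ b₀ → Good u (a , b) → Good v (a₀ , b₀) → p ∣ Δ b a₀ → Residue p ((u * v) * Δ a a₀)
compose-residue {p} {u} {v} {a} {b} {a₀} {b₀} pr a≢0 b≢0 ab≡a₀b₀ cop₀ good good₀ p∣Δba₀
  with p ∣? a₀
... | no p∤a₀ = residue-Δ {u = u} {v} {a} {a₀} pr (proj₁ (good p pr) p∣b) (proj₁ (good₀ p pr) p∣b₀)
  where
  p∣b : p ∣ b
  p∣b = euclidˡ pr (∣-trans p∣Δba₀ (Δ∣* b a₀)) p∤a₀
  p∣b₀ : p ∣ b₀
  p∣b₀ = euclidʳ pr (subst (p ∣_) ab≡a₀b₀ (∣n⇒∣m*n a p∣b)) p∤a₀
... | yes p∣a₀ = subst (λ z → Residue p ((u * v) * z)) (sym (Δ-swap a≢0 b≢0 ab≡a₀b₀))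
                   (residue-Δ {u = u} {v} {b} {b₀} pr (proj₂ (good p pr) p∣a) (proj₂ (good₀ p pr) p∣a₀))
  where
  p∤b₀ : ¬ p ∣ b₀
  p∤b₀ = coprime⇒¬common-prime cop₀ pr p∣a₀
  Δba₀≡Δab₀ : Δ b a₀ ≡ Δ a b₀
  Δba₀≡Δab₀ = Δ-swap b≢0 a≢0 (trans (ℕP.*-comm b a) ab≡a₀b₀)
  p∣a : p ∣ a
  p∣a = euclidˡ pr (∣-trans (subst (p ∣_) Δba₀≡Δab₀ p∣Δba₀) (Δ∣* a b₀)) p∤b₀

good-compose : ∀ {u v a b a₀ b₀} → a ≢ 0 → b ≢ 0 → a * b ≡ a₀ * b₀ → Coprime a₀ b₀ →
  Good u (a , b) → Good v (a₀ , b₀) → Good (u * v) (Δ a a₀ , Δ b a₀)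
good-compose {u} {v} {a} {b} a≢0 b≢0 ab≡a₀b₀ cop₀ good good₀ p pr =
    compose-residue {u = u} {v} pr a≢0 b≢0 ab≡a₀b₀ cop₀ good good₀
  , compose-residue {u = u} {v} pr b≢0 a≢0 (trans (ℕP.*-comm b a) ab≡a₀b₀) cop₀ (Good-swap {u} good) good₀

good-cancel : ∀ {g u a b} → Unit (a * b) g → Good ((g * g) * u) (a , b) → Good u (a , b)
good-cancel {g} {u} {a} {b} g-unit good p pr =
    (λ p∣b → cancel (proj₁ (good p pr) p∣b) (∣n⇒∣m*n a p∣b))
  , (λ p∣a → cancel (proj₂ (good p pr) p∣a) (∣m⇒∣m*n b p∣a))
  where
  cancel : ∀ {x} → Residue p (((g * g) * u) * x) → p ∣ a * b → Residue p (u * x)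
  cancel {x} res p∣ab = residue-cancel pr (g-unit p pr p∣ab) (subst (Residue p) (ℕP.*-assoc (g * g) u x) res)

module FactorPairs (D : ℕ) (D≢0 : D ≢ 0) (sf : SquareFree D) where

  FP : List (ℕ × ℕ)
  FP = factorPairs D

  ∈FP⁻ : ∀ {a b} → (a , b) ∈ FP → a * b ≡ D
  ∈FP⁻ ab∈ = proj₂ (∈-filter⁻ (λ (a , b) → a * b ℕ.≟ D) {xs = cartesianProduct (upTo (suc D)) (upTo (suc D))} ab∈)

  ∈FP⁺ : ∀ {a b} → a * b ≡ D → (a , b) ∈ FP
  ∈FP⁺ {a} {b} ab≡D = ∈-filter⁺ (λ (a , b) → a * b ℕ.≟ D)
    (∈-cartesianProduct⁺ (∈-upTo⁺ (s≤s (∣⇒≤ {{≢-nonZero D≢0}} (subst (a ∣_) ab≡D (m∣m*n b)))))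
                         (∈-upTo⁺ (s≤s (∣⇒≤ {{≢-nonZero D≢0}} (subst (b ∣_) ab≡D (n∣m*n a))))))
    ab≡D

  FP-unique : Unique FP
  FP-unique = Unique.filter⁺ (λ (a , b) → a * b ℕ.≟ D)
    (Unique.cartesianProduct⁺ (Unique.upTo⁺ (suc D)) (Unique.upTo⁺ (suc D)))

  ∈FP⇒≢0 : ∀ {a b} → (a , b) ∈ FP → a ≢ 0 × b ≢ 0
  ∈FP⇒≢0 {a} {b} ab∈ = (λ a≡0 → D≢0 (trans (sym (∈FP⁻ ab∈)) (cong (_* b) a≡0)))
                     , (λ b≡0 → D≢0 (trans (sym (∈FP⁻ ab∈)) (trans (cong (a *_) b≡0) (ℕP.*-zeroʳ a))))

  ∈FP⇒coprime : ∀ {a b} → (a , b) ∈ FP → Coprime a b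
  ∈FP⇒coprime {a} {b} ab∈ = squarefree-coprime {a = a} {b} sf D≢0 (∣-reflexive (∈FP⁻ ab∈))

  term-value : ∀ u {x} → x ∈ FP → Good u x → term u x ≡ + (2 ^ ω D)
  term-value u {a , b} ab∈ good = trans (term-good {u} good) (cong (λ k → + (2 ^ k)) (begin
    ω b + ω a      ≡⟨ ℕP.+-comm (ω b) (ω a) ⟩
    ω a + ω b      ≡⟨ ω-* (∈FP⇒coprime ab∈) (proj₁ (∈FP⇒≢0 ab∈)) (proj₂ (∈FP⇒≢0 ab∈)) ⟩
    ω (a * b)      ≡⟨ cong ω (∈FP⁻ ab∈) ⟩
    ω D            ∎))
    where open ≡-Reasoning

  2^ω>0 : + 0 ℤ.< + (2 ^ ω D)
  2^ω>0 = +<+ (ℕP.m^n>0 2 (ω D))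

  2^ω≢0 : + (2 ^ ω D) ≢ + 0
  2^ω≢0 = ℤP.<⇒≢ 2^ω>0 ∘ sym

  term-dichotomy : ∀ {u x} → Unit D u → x ∈ FP → term u x ≡ + 0 ⊎ Good u x
  term-dichotomy {u} {a , b} u-unit ab∈ with term u (a , b) ℤ.≟ + 0
  ... | yes term≡0 = inj₁ term≡0
  ... | no term≢0 = inj₂ (term≢0⇒good (proj₁ (∈FP⇒≢0 ab∈)) (proj₂ (∈FP⇒≢0 ab∈)) (∈FP⇒coprime ab∈)
                           (subst (λ n → Unit n u) (sym (∈FP⁻ ab∈)) u-unit) term≢0)

  term-nonneg : ∀ {u} → Unit D u → ∀ {x} → x ∈ FP → + 0 ℤ.≤ term u x
  term-nonneg {u} u-unit x∈ with term-dichotomy u-unit x∈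
  ... | inj₁ term≡0 = ℤP.≤-reflexive (sym term≡0)
  ... | inj₂ good = subst (+ 0 ℤ.≤_) (sym (term-value u x∈ good)) (ℤP.<⇒≤ 2^ω>0)

  term-cong : ∀ {u v x y} → Unit D u → Unit D v → x ∈ FP → y ∈ FP →
    (Good u x → Good v y) → (Good v y → Good u x) → term u x ≡ term v y
  term-cong {u} {v} u-unit v-unit x∈ y∈ x⇒y y⇒x with term-dichotomy u-unit x∈ | term-dichotomy v-unit y∈
  ... | inj₁ tx≡0 | inj₁ ty≡0 = trans tx≡0 (sym ty≡0)
  ... | inj₁ tx≡0 | inj₂ good-y = contradiction (trans (sym (term-value u x∈ (y⇒x good-y))) tx≡0) 2^ω≢0
  ... | inj₂ good-x | inj₁ ty≡0 = contradiction (trans (sym (term-value v y∈ (x⇒y good-x))) ty≡0) 2^ω≢0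
  ... | inj₂ good-x | inj₂ good-y = trans (term-value u x∈ good-x) (sym (term-value v y∈ good-y))

  -- S_D(1,1) > 0: all summands are ≥ 0 and the pair (D, 1) is 1-good.
  S₁-positive : + 0 ℤ.< S D (+ 1) (+ 1)
  S₁-positive = subst (+ 0 ℤ.<_) (sym (S≡Σterm D 1))
    (sumℤ-pos (term 1) FP (term-nonneg (one-unit D)) D1∈ (subst (+ 0 ℤ.<_) (sym (term-value 1 D1∈ good-D1)) 2^ω>0))
    where
    D1∈ : (D , 1) ∈ FP
    D1∈ = ∈FP⁺ (ℕP.*-identityʳ D)
    good-D1 : Good 1 (D , 1)
    good-D1 p pr = (λ p∣1 → contradiction p∣1 (prime∤1 pr)) , (λ _ → residue-one pr)

  module Reflection (odd : Odd D) {a₀ b₀ : ℕ} (ab₀∈ : (a₀ , b₀) ∈ FP) (good₀ : Good 2 (a₀ , b₀)) where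

    σ : ℕ × ℕ → ℕ × ℕ
    σ (a , b) = Δ a a₀ , Δ b a₀

    a₀≢0 : a₀ ≢ 0
    a₀≢0 = proj₁ (∈FP⇒≢0 ab₀∈)

    σ-closed : ∀ {x} → x ∈ FP → σ x ∈ FP
    σ-closed {a , b} ab∈ = ∈FP⁺ (Δ-factor-pair {D} {a} {b} {a₀} {b₀} sf D≢0 (∈FP⁻ ab∈) (∈FP⁻ ab₀∈))

    σ-involutive : ∀ {x} → x ∈ FP → σ (σ x) ≡ x
    σ-involutive {a , b} ab∈ = cong₂ _,_
      (Δ-involutive (squarefree-∣ (subst (a ∣_) (∈FP⁻ ab∈) (m∣m*n b)) sf) (proj₁ (∈FP⇒≢0 ab∈)) a₀≢0)
      (Δ-involutive (squarefree-∣ (subst (b ∣_) (∈FP⁻ ab∈) (n∣m*n a)) sf) (proj₂ (∈FP⇒≢0 ab∈)) a₀≢0)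

    compose₀ : ∀ {u x} → x ∈ FP → Good u x → Good (u * 2) (σ x)
    compose₀ {u} {a , b} ab∈ good = good-compose {u} {2} (proj₁ (∈FP⇒≢0 ab∈)) (proj₂ (∈FP⇒≢0 ab∈))
      (trans (∈FP⁻ ab∈) (sym (∈FP⁻ ab₀∈))) (∈FP⇒coprime ab₀∈) good good₀

    good₁⇒good₂ : ∀ {x} → x ∈ FP → Good 1 x → Good 2 (σ x)
    good₁⇒good₂ = compose₀ {1}

    -- Composing twice gives 4 = 2² times the multiplier, and 2 is a unit mod D.
    good₂⇒good₁ : ∀ {x} → x ∈ FP → Good 2 (σ x) → Good 1 x
    good₂⇒good₁ {a , b} ab∈ good =
      good-cancel {2} {1} (subst (λ n → Unit n 2) (sym (∈FP⁻ ab∈)) (two-unit odd))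
        (subst (Good 4) (σ-involutive ab∈) (compose₀ {2} (σ-closed ab∈) good))

    S₂≡S₁ : S D (+ 2) (+ 2) ≡ S D (+ 1) (+ 1)
    S₂≡S₁ = begin
      S D (+ 2) (+ 2)                  ≡⟨ S≡Σterm D 2 ⟩
      sumℤ (map (term 2) FP)           ≡⟨ sumℤ-↭ (map⁺ (term 2) (↭-sym σ-permutes)) ⟩
      sumℤ (map (term 2) (map σ FP))   ≡⟨ cong sumℤ (List.map-∘ FP) ⟨
      sumℤ (map (term 2 ∘ σ) FP)       ≡⟨ cong sumℤ (List.map-cong-local (All.tabulate reflect)) ⟩
      sumℤ (map (term 1) FP)           ≡⟨ S≡Σterm D 1 ⟨
      S D (+ 1) (+ 1)                  ∎
      where
      open ≡-Reasoning
      σ-permutes : map σ FP ↭ FP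
      σ-permutes = involution-↭ FP-unique σ-closed σ-involutive
      reflect : ∀ {x} → x ∈ FP → term 2 (σ x) ≡ term 1 x
      reflect x∈ = term-cong (two-unit odd) (one-unit D) (σ-closed x∈) x∈ (good₂⇒good₁ x∈) (good₁⇒good₂ x∈)

  S₂-dichotomy : Odd D → S D (+ 2) (+ 2) ≡ + 0 ⊎ S D (+ 2) (+ 2) ≡ S D (+ 1) (+ 1)
  S₂-dichotomy odd with S D (+ 2) (+ 2) ℤ.≟ + 0
  ... | yes S₂≡0 = inj₁ S₂≡0
  ... | no S₂≢0 with sumℤ≢0⇒term≢0 (term 2) FP (λ Σ≡0 → S₂≢0 (trans (S≡Σterm D 2) Σ≡0))
  ...   | x₀ , x₀∈ , term≢0 with term-dichotomy (two-unit odd) x₀∈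
  ...     | inj₁ term≡0 = contradiction term≡0 term≢0
  ...     | inj₂ good₀ = inj₂ (Reflection.S₂≡S₁ odd x₀∈ good₀)

mainTheorem7 : (D : ℕ) → D > 0 → Odd D → SquareFree D →
    (¬ (S D (+ 1) (+ 1) ≡ + 0))
      × ((S D (+ 2) (+ 2) ≡ + 0) ⊎ (S D (+ 2) (+ 2) ≡ S D (+ 1) (+ 1)))
mainTheorem7 D D>0 odd sf = S₁≢0 , S₂-dichotomy odd
  where
  open FactorPairs D (ℕP.>⇒≢ D>0) sf
  S₁≢0 : ¬ (S D (+ 1) (+ 1) ≡ + 0)
  S₁≢0 S₁≡0 = ℤP.<⇒≢ S₁-positive (sym S₁≡0)
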